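{- Let $n,k,t$ be positive integers with $n>k>t$, and suppose a Generalized Euler Square of index $n,k,t$ with tuples $a(\mathbf i)$, $\mathbf i=(i_1,\dots,i_{t+1})\in\{1,\dots,n\}^{t+1}$, exists. Let $\Phi(n,k,t)$ be the $nk\times n^{t+1}$ binary matrix whose columns are the vectors attached to the tuples $a(\mathbf i)$, ordered so that each group of $n$ consecutive columns consists of the vectors attached to the $n$ tuples $a(i_1,\dots,i_t,u)$, $u=1,\dots,n$, for a fixed $(i_1,\dots,i_t)$. Then $\frac{1}{\sqrt{k}}\Phi(n,k,t)$ is a (sparse) $nk\times n^{t+1}$ matrix consisting of $n^{t}$ blocks, each of size $nk\times n$, and each block has orthonormal columns.
   Context: A Generalized Euler Square (GES) of index $n,k,t$, with $n>k>t\ge1$, is a family of $n^{t+1}$ $k$-tuples $a(\mathbf i)=(a_{\mathbf i,1},\dots,a_{\mathbf i,k})$ indexed by $\mathbf i\in\{1,\dots,n\}^{t+1}$, with entries in $\{0,\dots,n-1\}$, such that: (1) if $\mathbf i,\mathbf j$ differ in exactly one position then $a_{\mathbf i,r}\neq a_{\mathbf j,r}$ for all $r$; (2) if $\mathbf i,\mathbf j$ differ in at least two positions then the tuples agree in at most $t$ coordinates. To a $k$-tuple $(t_1,\dots,t_k)$ with entries in $\{0,\dots,n-1\}$ one attaches $v\in\{0,1\}^{nk}$ with $v(i)=1$ iff $i=(l-1)n+t_l+1$ for some $1\le l\le k$. -}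

module Defs where

import Data.Nat
open import Data.Nat using (ℕ; _>_; zero; suc; _+_; _*_; _≤_)
open import Data.Fin using (Fin; zero; suc; remQuot; _≟_)
open import Data.Vec using (Vec; lookup; _∷ʳ_)
open import Data.Bool using (Bool; true; false; if_then_else_)
open import Data.Product using (_×_; _,_)
open import Relation.Nullary using (does)
open import Relation.Binary.PropositionalEquality using (_≡_; _≢_)
open import Data.Integer using (+_)
import Data.Rational as ℚ
open ℚ using (ℚ)

sumFin : (m : ℕ) → (Fin m → ℕ) → ℕ
sumFin zero    f = 0
sumFin (suc m) f = f zero + sumFin m (λ i → f (suc i))

countFin : (m : ℕ) → (Fin m → Bool) → ℕ
countFin m p = sumFin m (λ i → if p i then 1 else 0)

-- Indices i ∈ {1..n}^(t+1) are represented 0-based as Vec (Fin n) (suc t);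
-- entries of the k-tuples are in Fin n = {0,…,n-1}.
Index : ℕ → ℕ → Set
Index n t = Vec (Fin n) (suc t)

diffPositions : ∀ {n t} → Index n t → Index n t → ℕ
diffPositions {n} {t} i j =
  countFin (suc t) (λ p → if does (lookup i p ≟ lookup j p) then false else true)

agreeCoords : ∀ {n k} → (Fin k → Fin n) → (Fin k → Fin n) → ℕ
agreeCoords {n} {k} x y = countFin k (λ r → does (x r ≟ y r))

record IsGES (n k t : ℕ) (a : Index n t → Fin k → Fin n) : Set where
  field
    oneDiff : ∀ (i j : Index n t) → diffPositions i j ≡ 1 →
              ∀ (r : Fin k) → a i r ≢ a j r
    manyDiff : ∀ (i j : Index n t) → 2 ≤ diffPositions i j →
               agreeCoords (a i) (a j) ≤ t

-- The vector v ∈ {0,1}^{nk} attached to a k-tuple (t_1,…,t_k):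
-- rows 0-based, row r = l*n + s (l : Fin k, s : Fin n), and v(r) = 1 iff s = t_l.
-- (This is v(i)=1 iff i=(l-1)n+t_l+1 in 1-based indexing.)
attached : ∀ {n k} → (Fin k → Fin n) → Fin (k * n) → ℕ
attached {n} {k} tup r with remQuot {k} n r
... | l , s = if does (tup l ≟ s) then 1 else 0

-- Column of Φ(n,k,t) belonging to the index (i_1,…,i_t,u):
-- the block with fixed prefix p = (i_1,…,i_t) has columns u ↦ column (p ∷ʳ u).
blockColumn : ∀ {n k t} → (Index n t → Fin k → Fin n) →
              Vec (Fin n) t → Fin n → Fin (k * n) → ℕ
blockColumn a p u = attached (a (p ∷ʳ u))

δ : ∀ {n} → Fin n → Fin n → ℚ
δ u v = if does (u ≟ v) then ℚ.1ℚ else ℚ.0ℚ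

-- Inner product of two columns of (1/√k)·Φ :
-- Σ_r (c r / √k)(c' r / √k) = (1/k) Σ_r c r · c' r.
scaledInner : ∀ (n k : ℕ) .{{_ : Data.Nat.NonZero k}} →
              (Fin (k * n) → ℕ) → (Fin (k * n) → ℕ) → ℚ
scaledInner n k c c' = (+ sumFin (k * n) (λ r → c r * c' r)) ℚ./ k

-- Fix a prefix p = (i₁,…,iₜ).  The block of Φ(n,k,t) belonging to p has the
-- columns c_u = attached (a (p ∷ʳ u)).  The proof rests on one identity:
-- the inner product of the 0/1 vectors attached to two k-tuples x, y equals
-- the number of coordinates in which x and y agree (a row r = (l , s) of
-- the attached vectors contributes 1 exactly when x l = s = y l).  Hence
--   * c_u · c_u = k, since a tuple agrees with itself everywhere;
--   * c_u · c_v = 0 for u ≠ v, since p ∷ʳ u and p ∷ʳ v differ in exactly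
--     one position, so condition (1) of a GES makes the tuples disagree in
--     every coordinate.
-- Dividing by k gives δ u v.  Only condition (1) of the GES is needed.
module Submission where

open import Defs
open import Data.Nat using (ℕ; _<_; _≤_; NonZero; zero; suc; _+_; _*_)
open import Data.Nat.Properties using (+-assoc; +-identityʳ; *-identityʳ; *-zeroʳ)
open import Data.Fin using (Fin; zero; suc; remQuot; _↑ˡ_; _↑ʳ_; _≟_)
open import Data.Fin.Properties using (splitAt-↑ˡ; splitAt-↑ʳ)
open import Data.Vec using (Vec; []; _∷_; _∷ʳ_)
open import Data.Bool using (if_then_else_)
open import Data.Product using (_,_)
open import Relation.Nullary using (does; yes; no)
open import Relation.Nullary.Negation using (contradiction)
open import Relation.Binary.PropositionalEquality
  using (_≡_; _≢_; refl; sym; trans; cong; cong₂; module ≡-Reasoning)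
open import Data.Integer using () renaming (+_ to ℤ+_)
import Data.Integer.Properties as ℤ
import Data.Rational as ℚ
import Data.Rational.Properties as ℚ
import Data.Rational.Unnormalised as ℚᵘ

open ≡-Reasoning

sumFin-cong : ∀ m {f g : Fin m → ℕ} → (∀ i → f i ≡ g i) → sumFin m f ≡ sumFin m g
sumFin-cong zero    f≡g = refl
sumFin-cong (suc m) f≡g = cong₂ _+_ (f≡g zero) (sumFin-cong m (λ i → f≡g (suc i)))

sumFin-split : ∀ a b (f : Fin (a + b) → ℕ) →
  sumFin (a + b) f ≡ sumFin a (λ i → f (i ↑ˡ b)) + sumFin b (λ j → f (a ↑ʳ j))
sumFin-split zero    b f = refl
sumFin-split (suc a) b f = begin
  f zero + sumFin (a + b) (λ i → f (suc i))
    ≡⟨ cong (f zero +_) (sumFin-split a b (λ i → f (suc i))) ⟩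
  f zero + (sumFin a (λ i → f (suc (i ↑ˡ b))) + sumFin b (λ j → f (suc a ↑ʳ j)))
    ≡⟨ sym (+-assoc (f zero) _ _) ⟩
  f zero + sumFin a (λ i → f (suc (i ↑ˡ b))) + sumFin b (λ j → f (suc a ↑ʳ j)) ∎

sumFin-remQuot : ∀ k n (g : Fin k → Fin n → ℕ) →
  sumFin (k * n) (λ r → let (l , s) = remQuot {k} n r in g l s)
    ≡ sumFin k (λ l → sumFin n (g l))
sumFin-remQuot zero    n g = refl
sumFin-remQuot (suc k) n g = begin
  sumFin (n + k * n) (λ r → let (l , s) = remQuot {suc k} n r in g l s)
    ≡⟨ sumFin-split n (k * n) _ ⟩
  sumFin n (λ s → let (l , s′) = remQuot {suc k} n (s ↑ˡ (k * n)) in g l s′)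
    + sumFin (k * n) (λ r → let (l , s) = remQuot {suc k} n (n ↑ʳ r) in g l s)
    ≡⟨ cong₂ _+_ (sumFin-cong n firstBlock) (sumFin-cong (k * n) laterBlocks) ⟩
  sumFin n (g zero) + sumFin (k * n) (λ r → let (l , s) = remQuot {k} n r in g (suc l) s)
    ≡⟨ cong (sumFin n (g zero) +_) (sumFin-remQuot k n (λ l → g (suc l))) ⟩
  sumFin n (g zero) + sumFin k (λ l → sumFin n (g (suc l))) ∎
  where
  firstBlock : ∀ s → (let (l , s′) = remQuot {suc k} n (s ↑ˡ (k * n)) in g l s′) ≡ g zero s
  firstBlock s rewrite splitAt-↑ˡ n s (k * n) = refl
  laterBlocks : ∀ r → (let (l , s) = remQuot {suc k} n (n ↑ʳ r) in g l s)
                    ≡ (let (l , s) = remQuot {k} n r in g (suc l) s)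
  laterBlocks r rewrite splitAt-↑ʳ n (k * n) r = refl

sumFin-select : ∀ n (x : Fin n) (f : Fin n → ℕ) →
  sumFin n (λ s → if does (x ≟ s) then f s else 0) ≡ f x
sumFin-select (suc n) zero    f = trans (cong (f zero +_) (sumFin-zero n)) (+-identityʳ (f zero))
  where
  sumFin-zero : ∀ m → sumFin m (λ _ → 0) ≡ 0
  sumFin-zero zero    = refl
  sumFin-zero (suc m) = sumFin-zero m
sumFin-select (suc n) (suc x) f =
  trans (sumFin-cong n shift) (sumFin-select n x (λ i → f (suc i)))
  where
  shift : ∀ i → (if does (suc x ≟ suc i) then f (suc i) else 0)
              ≡ (if does (x ≟ i) then f (suc i) else 0)
  shift i with x ≟ i
  ... | yes _ = refl
  ... | no  _ = refl

indicator : ∀ {n} → Fin n → Fin n → ℕ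
indicator x s = if does (x ≟ s) then 1 else 0

attached-remQuot : ∀ {n k} (x : Fin k → Fin n) (r : Fin (k * n)) →
  attached x r ≡ (let (l , s) = remQuot {k} n r in indicator (x l) s)
attached-remQuot {n} {k} x r with remQuot {k} n r
... | l , s = refl

indicator-product : ∀ {n} (x y s : Fin n) →
  indicator x s * indicator y s ≡ (if does (y ≟ s) then indicator x s else 0)
indicator-product x y s with y ≟ s
... | yes _ = *-identityʳ (indicator x s)
... | no  _ = *-zeroʳ (indicator x s)

attached-inner : ∀ n k (x y : Fin k → Fin n) →
  sumFin (k * n) (λ r → attached x r * attached y r) ≡ agreeCoords x y
attached-inner n k x y = begin
  sumFin (k * n) (λ r → attached x r * attached y r)
    ≡⟨ sumFin-cong (k * n) (λ r → cong₂ _*_ (attached-remQuot x r) (attached-remQuot y r)) ⟩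
  sumFin (k * n) (λ r → let (l , s) = remQuot {k} n r in indicator (x l) s * indicator (y l) s)
    ≡⟨ sumFin-remQuot k n (λ l s → indicator (x l) s * indicator (y l) s) ⟩
  sumFin k (λ l → sumFin n (λ s → indicator (x l) s * indicator (y l) s))
    ≡⟨ sumFin-cong k (λ l → trans (sumFin-cong n (indicator-product (x l) (y l)))
                                  (sumFin-select n (y l) (indicator (x l)))) ⟩
  sumFin k (λ l → indicator (x l) (y l)) ∎

agreeCoords-self : ∀ {n} k (x : Fin k → Fin n) → agreeCoords x x ≡ k
agreeCoords-self zero    x = refl
agreeCoords-self (suc k) x with x zero ≟ x zero
... | yes _  = cong suc (agreeCoords-self k (λ i → x (suc i)))
... | no  ne = contradiction refl ne

agreeCoords-apart : ∀ {n} k (x y : Fin k → Fin n) → (∀ r → x r ≢ y r) → agreeCoords x y ≡ 0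
agreeCoords-apart zero    x y apart = refl
agreeCoords-apart (suc k) x y apart with x zero ≟ y zero
... | yes eq = contradiction eq (apart zero)
... | no  _  = agreeCoords-apart k (λ i → x (suc i)) (λ i → y (suc i)) (λ r → apart (suc r))

diffPositions-lastOnly : ∀ {n} t (p : Vec (Fin n) t) (u v : Fin n) → u ≢ v →
  diffPositions {n} {t} (p ∷ʳ u) (p ∷ʳ v) ≡ 1
diffPositions-lastOnly zero    []      u v u≢v with u ≟ v
... | yes u≡v = contradiction u≡v u≢v
... | no  _   = refl
diffPositions-lastOnly (suc t) (x ∷ p) u v u≢v with x ≟ x
... | yes _  = diffPositions-lastOnly t p u v u≢v
... | no  ne = contradiction refl ne

k/k≡1 : ∀ k .{{_ : NonZero k}} → (ℤ+ k) ℚ./ k ≡ ℚ.1ℚ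
k/k≡1 k@(suc k-1) = ℚ.fromℚᵘ-cong {ℚᵘ.mkℚᵘ (ℤ+ k) k-1} {ℚᵘ.1ℚᵘ}
  (ℚᵘ.*≡* (trans (ℤ.*-identityʳ (ℤ+ k)) (sym (ℤ.*-identityˡ (ℤ+ k)))))

mainTheorem7 : (n k t : ℕ) → 1 ≤ t → t < k → k < n → .{{_ : NonZero k}} →
    (a : Index n t → Fin k → Fin n) → IsGES n k t a →
    (p : Vec (Fin n) t) → (u v : Fin n) →
    scaledInner n k (blockColumn a p u) (blockColumn a p v) ≡ δ u v
mainTheorem7 n k t _ _ _ a ges p u v with u ≟ v
... | yes refl = begin
  (ℤ+ sumFin (k * n) (λ r → blockColumn a p u r * blockColumn a p u r)) ℚ./ k
    ≡⟨ cong (λ m → (ℤ+ m) ℚ./ k) (attached-inner n k (a (p ∷ʳ u)) (a (p ∷ʳ u))) ⟩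
  (ℤ+ agreeCoords (a (p ∷ʳ u)) (a (p ∷ʳ u))) ℚ./ k
    ≡⟨ cong (λ m → (ℤ+ m) ℚ./ k) (agreeCoords-self k (a (p ∷ʳ u))) ⟩
  (ℤ+ k) ℚ./ k
    ≡⟨ k/k≡1 k ⟩
  ℚ.1ℚ ∎
... | no u≢v = begin
  (ℤ+ sumFin (k * n) (λ r → blockColumn a p u r * blockColumn a p v r)) ℚ./ k
    ≡⟨ cong (λ m → (ℤ+ m) ℚ./ k) (attached-inner n k (a (p ∷ʳ u)) (a (p ∷ʳ v))) ⟩
  (ℤ+ agreeCoords (a (p ∷ʳ u)) (a (p ∷ʳ v))) ℚ./ k
    ≡⟨ cong (λ m → (ℤ+ m) ℚ./ k) (agreeCoords-apart k _ _ columnsApart) ⟩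
  (ℤ+ 0) ℚ./ k
    ≡⟨ ℚ.0/n≡0 k ⟩
  ℚ.0ℚ ∎
  where
  columnsApart : ∀ r → a (p ∷ʳ u) r ≢ a (p ∷ʳ v) r
  columnsApart = IsGES.oneDiff ges (p ∷ʳ u) (p ∷ʳ v) (diffPositions-lastOnly t p u v u≢v)
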